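{- Let $n$ be a positive integer with $\phi(n)=\frac{2}{3}\cdot (n+1)$, where $\phi$ is Euler's totient function, and let $p$ and $r$ be two primes with $pr\mid n$. Then $p\nmid (r-1)$. -}

module Defs where

open import Data.Nat using (ℕ; suc; _≟_)
open import Data.Nat.GCD using (gcd)
open import Data.List using (List; length; filter; upTo; map)
open import Relation.Nullary.Decidable using (Dec)

φ : ℕ → ℕ
φ n = length (filter (λ k → gcd k n ≟ 1) (map suc (upTo n)))

-- If 3 φ(n) = 2 (n + 1) then n is odd: for even n every k coprime to n is odd, so φ(n) ≤ n / 2.
-- For a prime r ∣ n we have (r − 1) ∣ φ(n), so p ∣ r − 1 gives p ∣ φ(n) ∣ 2 (n + 1), which with
-- p ∣ n forces p ∣ 2, i.e. p = 2 ∣ n: impossible. The divisibility (r − 1) ∣ φ(n) follows by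
-- induction from φ(r m) = r φ(m) for r ∣ m and φ(r m) = (r − 1) φ(m) for r ∤ m. Both come from
-- counting the k ≤ r m coprime to m: by periodicity there are r φ(m) of them; those not divisible
-- by r are exactly the ones coprime to r m, and the multiples r j among them are none if r ∣ m,
-- and correspond to the j ≤ m coprime to m if r ∤ m.
module Submission where

open import Level using (Level)
open import Data.Bool.Base using (true; false; if_then_else_)
open import Data.List.Base using (_++_; [_]; length; filter; map; upTo)
open import Data.List.Properties using (filter-++; length-++; map-++; upTo-∷ʳ)
open import Data.Nat.Base
open import Data.Nat.Properties
open import Algebra.Properties.CommutativeSemigroup +-commutativeSemigroup using (interchange)
open import Data.Nat.Divisibility
open import Data.Nat.Coprimality using (Coprime; coprime?; gcd≡1⇒coprime; coprime⇒gcd≡1; coprime-divisor)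
import Data.Nat.Coprimality as C
open import Data.Nat.GCD using (gcd)
open import Data.Nat.Induction using (<-rec)
open import Data.Nat.Tactic.RingSolver using (solve-∀)
open import Data.Nat.Primality using (Prime; prime[2]; prime⇒irreducible; prime⇒nonZero; prime⇒nonTrivial)
open import Data.Sum.Base using (inj₁; inj₂; fromInj₂)
open import Data.Product.Base using (_×_; _,_; proj₂)
open import Function.Base using (_∘_)
open import Function.Bundles using (_⇔_; mk⇔)
open import Relation.Nullary.Decidable using (Dec; yes; no; _because_; does; does-⇔; _×-dec_; ¬?)
open import Relation.Nullary.Negation using (¬_; contradiction)
open import Relation.Unary using (Pred; Decidable; _⊆_)
open import Relation.Unary.Properties using (_∩?_; ∁?)
open import Relation.Binary.PropositionalEquality hiding ([_])

open import Defs

private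
  variable
    ℓ ℓ′ : Level
    P : Pred ℕ ℓ

𝟙 : {A : Set ℓ} → Dec A → ℕ
𝟙 A? = if does A? then 1 else 0

count : Decidable P → ℕ → ℕ
count P? zero    = 0
count P? (suc n) = count P? n + 𝟙 (P? (suc n))

length-filter-[1‥n]≡count : (P? : Decidable P) (n : ℕ) →
                             length (filter P? (map suc (upTo n))) ≡ count P? n
length-filter-[1‥n]≡count P? zero    = refl
length-filter-[1‥n]≡count P? (suc n) = begin
  length (filter P? (map suc (upTo (suc n))))
    ≡⟨ cong (length ∘ filter P?)
            (trans (cong (map suc) (sym (upTo-∷ʳ n))) (map-++ suc (upTo n) [ n ])) ⟩
  length (filter P? (map suc (upTo n) ++ [ suc n ]))
    ≡⟨ cong length (filter-++ P? (map suc (upTo n)) [ suc n ]) ⟩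
  length (filter P? (map suc (upTo n)) ++ filter P? [ suc n ])
    ≡⟨ length-++ (filter P? (map suc (upTo n))) ⟩
  length (filter P? (map suc (upTo n))) + length (filter P? [ suc n ])
    ≡⟨ cong₂ _+_ (length-filter-[1‥n]≡count P? n) (length-filter-singleton (suc n)) ⟩
  count P? (suc n) ∎
  where
  open ≡-Reasoning
  length-filter-singleton : ∀ x → length (filter P? [ x ]) ≡ 𝟙 (P? x)
  length-filter-singleton x with does (P? x)
  ... | true  = refl
  ... | false = refl

module _ {P : Pred ℕ ℓ} {Q : Pred ℕ ℓ′} (P? : Decidable P) (Q? : Decidable Q) where

  count-cong : (∀ k → P k ⇔ Q k) → ∀ n → count P? n ≡ count Q? n
  count-cong P⇔Q zero    = refl
  count-cong P⇔Q (suc n) = cong₂ _+_ (count-cong P⇔Q n)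
    (cong (λ b → if b then 1 else 0) (does-⇔ (P⇔Q (suc n)) (P? (suc n)) (Q? (suc n))))

  count-mono-≤ : P ⊆ Q → ∀ n → count P? n ≤ count Q? n
  count-mono-≤ P⊆Q zero    = z≤n
  count-mono-≤ P⊆Q (suc n) = +-mono-≤ (count-mono-≤ P⊆Q n) (𝟙-mono (P? (suc n)) (Q? (suc n)))
    where
    𝟙-mono : ∀ {k} (p? : Dec (P k)) (q? : Dec (Q k)) → 𝟙 p? ≤ 𝟙 q?
    𝟙-mono (false because _) _                  = z≤n
    𝟙-mono (true because _)  (true because _)   = ≤-refl
    𝟙-mono (yes p)           (no ¬q)            = contradiction (P⊆Q p) ¬q

  count-split : ∀ n → count P? n ≡ count (P? ∩? Q?) n + count (P? ∩? ∁? Q?) n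
  count-split zero    = refl
  count-split (suc n) = begin
    count P? n + 𝟙 (P? (suc n))
      ≡⟨ cong₂ _+_ (count-split n) (𝟙-split (P? (suc n)) (Q? (suc n))) ⟩
    (count (P? ∩? Q?) n + count (P? ∩? ∁? Q?) n)
      + (𝟙 ((P? ∩? Q?) (suc n)) + 𝟙 ((P? ∩? ∁? Q?) (suc n)))
      ≡⟨ interchange (count (P? ∩? Q?) n) _ _ _ ⟩
    count (P? ∩? Q?) (suc n) + count (P? ∩? ∁? Q?) (suc n) ∎
    where
    open ≡-Reasoning
    𝟙-split : ∀ {k} (p? : Dec (P k)) (q? : Dec (Q k)) → 𝟙 p? ≡ 𝟙 (p? ×-dec q?) + 𝟙 (p? ×-dec ¬? q?)
    𝟙-split (false because _) _                 = refl
    𝟙-split (true because _)  (true because _)  = refl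
    𝟙-split (true because _)  (false because _) = refl

module _ {P : Pred ℕ ℓ} (P? : Decidable P) where

  count-+ : ∀ m n → count P? (m + n) ≡ count P? m + count (P? ∘ (m +_)) n
  count-+ m zero    = trans (cong (count P?) (+-identityʳ m)) (sym (+-identityʳ _))
  count-+ m (suc n) rewrite +-suc m n | count-+ m n = +-assoc (count P? m) _ _

  count-none : ∀ n → (∀ {k} → 0 < k → k ≤ n → ¬ P k) → count P? n ≡ 0
  count-none zero    _    = refl
  count-none (suc n) none with P? (suc n)
  ... | yes p = contradiction p (none z<s ≤-refl)
  ... | no  _ = trans (+-identityʳ _) (count-none n (λ 0<k k≤n → none 0<k (m≤n⇒m≤1+n k≤n)))

  count-periodic : ∀ {N} → (∀ k → P (N + k) ⇔ P k) → ∀ q → count P? (q * N) ≡ q * count P? N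
  count-periodic         shift zero    = refl
  count-periodic {N = N} shift (suc q) = begin
    count P? (N + q * N)
      ≡⟨ count-+ N (q * N) ⟩
    count P? N + count (P? ∘ (N +_)) (q * N)
      ≡⟨ cong (count P? N +_) (count-cong (P? ∘ (N +_)) P? shift (q * N)) ⟩
    count P? N + count P? (q * N)
      ≡⟨ cong (count P? N +_) (count-periodic shift q) ⟩
    count P? N + q * count P? N ∎
    where open ≡-Reasoning

count-multiples : (P? : Decidable P) → ∀ r .{{_ : NonZero r}} → P ⊆ (r ∣_) →
                  ∀ N → count P? (r * N) ≡ count (P? ∘ (r *_)) N
count-multiples P? r        P⊆r∣ zero    = cong (count P?) (*-zeroʳ r)
count-multiples {P = P} P? (suc r′) P⊆r∣ (suc N) = begin
  count P? (r * suc N)                                         ≡⟨ cong (count P?) r[1+N]≡rN+r ⟩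
  count P? (r * N + r)                                         ≡⟨ count-+ P? (r * N) r ⟩
  count P? (r * N) + (count (P? ∘ (r * N +_)) r′ + 𝟙 (P? (r * N + r)))
    ≡⟨ cong (λ c → count P? (r * N) + (c + 𝟙 (P? (r * N + r))))
            (count-none (P? ∘ (r * N +_)) r′ gap) ⟩
  count P? (r * N) + 𝟙 (P? (r * N + r))
    ≡⟨ cong₂ _+_ (count-multiples P? r P⊆r∣ N) (cong (𝟙 ∘ P?) (sym r[1+N]≡rN+r)) ⟩
  count (P? ∘ (r *_)) (suc N)                                  ∎
  where
  open ≡-Reasoning
  r = suc r′
  r[1+N]≡rN+r : r * suc N ≡ r * N + r
  r[1+N]≡rN+r = trans (*-suc r N) (+-comm r (r * N))
  gap : ∀ {k} → 0 < k → k ≤ r′ → ¬ P (r * N + k)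
  gap {suc k} _ k≤r′ p = <⇒≱ (s≤s k≤r′) (∣⇒≤ (∣m+n∣m⇒∣n (P⊆r∣ p) (m∣m*n N)))

prime⇒≢1 : ∀ {p} → Prime p → p ≢ 1
prime⇒≢1 pp = nonTrivial⇒≢1 {{prime⇒nonTrivial pp}}

coprime-+ˡ⇔ : ∀ {m n} → Coprime (n + m) n ⇔ Coprime m n
coprime-+ˡ⇔ = mk⇔ (λ c {_} (d∣m , d∣n) → c (∣m∣n⇒∣m+n d∣n d∣m , d∣n))
                  (λ c {_} (d∣n+m , d∣n) → c (∣m+n∣m⇒∣n d∣n+m d∣n , d∣n))

coprime-*ˡ : ∀ {m n o} → Coprime m o → Coprime n o → Coprime (m * n) o
coprime-*ˡ cmo cno (d∣mn , d∣o) =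
  cno (coprime-divisor (λ {_} (e∣d , e∣m) → cmo (e∣m , ∣-trans e∣d d∣o)) d∣mn , d∣o)

prime∤⇒coprime : ∀ {p k} → Prime p → p ∤ k → Coprime p k
prime∤⇒coprime pp p∤k (d∣p , d∣k) with prime⇒irreducible pp d∣p
... | inj₁ d≡1    = d≡1
... | inj₂ refl   = contradiction d∣k p∤k

coprime[k,p*n]⇔coprime[k,n]×p∤k : ∀ {p k n} → Prime p → Coprime k (p * n) ⇔ (Coprime k n × p ∤ k)
coprime[k,p*n]⇔coprime[k,n]×p∤k {p} {k} {n} pp = mk⇔ to from
  where
  to : Coprime k (p * n) → Coprime k n × p ∤ k
  to c = (λ (d∣k , d∣n) → c (d∣k , ∣n⇒∣m*n p d∣n)) , (λ p∣k → prime⇒≢1 pp (c (p∣k , m∣m*n n)))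
  from : Coprime k n × p ∤ k → Coprime k (p * n)
  from (ckn , p∤k) = C.sym (coprime-*ˡ (prime∤⇒coprime pp p∤k) (C.sym ckn))

coprimeTo? : ∀ n → Decidable (λ k → Coprime k n)
coprimeTo? n k = coprime? k n

φ≡count : ∀ n → φ n ≡ count (coprimeTo? n) n
φ≡count n = trans (length-filter-[1‥n]≡count (λ k → gcd k n ≟ 1) n)
                  (count-cong _ _ (λ _ → mk⇔ gcd≡1⇒coprime coprime⇒gcd≡1) n)

module _ {p} (pp : Prime p) where

  private instance
    p≢0 : NonZero p
    p≢0 = prime⇒nonZero pp

  coprimeTo?∩p∣? : ∀ n → Decidable (λ k → Coprime k n × p ∣ k)
  coprimeTo?∩p∣? n = coprimeTo? n ∩? (p ∣?_)

  count-coprime-multiples : ∀ n → count (coprimeTo?∩p∣? n) (p * n)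
                                ≡ count (coprimeTo?∩p∣? n ∘ (p *_)) n
  count-coprime-multiples n = count-multiples (coprimeTo?∩p∣? n) p proj₂ n

  φ[p*n]+count≡p*φ[n] : ∀ n → φ (p * n) + count (coprimeTo?∩p∣? n) (p * n) ≡ p * φ n
  φ[p*n]+count≡p*φ[n] n = begin
    φ (p * n) + count (coprimeTo?∩p∣? n) (p * n)
      ≡⟨ +-comm (φ (p * n)) _ ⟩
    count (coprimeTo?∩p∣? n) (p * n) + φ (p * n)
      ≡⟨ cong (count (coprimeTo?∩p∣? n) (p * n) +_) (φ≡count (p * n)) ⟩
    count (coprimeTo?∩p∣? n) (p * n) + count (coprimeTo? (p * n)) (p * n)
      ≡⟨ cong (count (coprimeTo?∩p∣? n) (p * n) +_)
              (count-cong _ _ (λ _ → coprime[k,p*n]⇔coprime[k,n]×p∤k pp) (p * n)) ⟩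
    count (coprimeTo?∩p∣? n) (p * n) + count (coprimeTo? n ∩? ∁? (p ∣?_)) (p * n)
      ≡⟨ count-split (coprimeTo? n) (p ∣?_) (p * n) ⟨
    count (coprimeTo? n) (p * n)
      ≡⟨ count-periodic (coprimeTo? n) (λ _ → coprime-+ˡ⇔) p ⟩
    p * count (coprimeTo? n) n
      ≡⟨ cong (p *_) (φ≡count n) ⟨
    p * φ n ∎
    where open ≡-Reasoning

  p∣n⇒φ[p*n]≡p*φ[n] : ∀ {n} → p ∣ n → φ (p * n) ≡ p * φ n
  p∣n⇒φ[p*n]≡p*φ[n] {n} p∣n = begin
    φ (p * n)                                         ≡⟨ +-identityʳ _ ⟨
    φ (p * n) + 0                                     ≡⟨ cong (φ (p * n) +_) no-coprime-multiples ⟨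
    φ (p * n) + count (coprimeTo?∩p∣? n) (p * n)     ≡⟨ φ[p*n]+count≡p*φ[n] n ⟩
    p * φ n                                           ∎
    where
    open ≡-Reasoning
    no-coprime-multiples : count (coprimeTo?∩p∣? n) (p * n) ≡ 0
    no-coprime-multiples = trans (count-coprime-multiples n)
      (count-none (coprimeTo?∩p∣? n ∘ (p *_)) n (λ _ _ (c , _) → prime⇒≢1 pp (c (m∣m*n _ , p∣n))))

  p∤n⇒φ[p*n]≡[p∸1]*φ[n] : ∀ {n} → p ∤ n → φ (p * n) ≡ (p ∸ 1) * φ n
  p∤n⇒φ[p*n]≡[p∸1]*φ[n] {n} p∤n = +-cancelˡ-≡ (φ n) _ _ (begin
    φ n + φ (p * n)                                   ≡⟨ +-comm (φ n) _ ⟩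
    φ (p * n) + φ n                                   ≡⟨ cong (φ (p * n) +_) all-coprime-multiples ⟨
    φ (p * n) + count (coprimeTo?∩p∣? n) (p * n)     ≡⟨ φ[p*n]+count≡p*φ[n] n ⟩
    p * φ n                                           ≡⟨ cong (_* φ n) (suc-pred p) ⟨
    φ n + (p ∸ 1) * φ n                               ∎)
    where
    open ≡-Reasoning
    coprime[p*j,n]⇔coprime[j,n] : ∀ j → (Coprime (p * j) n × p ∣ p * j) ⇔ Coprime j n
    coprime[p*j,n]⇔coprime[j,n] j = mk⇔ to from
      where
      to : Coprime (p * j) n × p ∣ p * j → Coprime j n
      to (c , _) (d∣j , d∣n) = c (∣n⇒∣m*n p d∣j , d∣n)
      from : Coprime j n → Coprime (p * j) n × p ∣ p * j
      from c = coprime-*ˡ (prime∤⇒coprime pp p∤n) c , m∣m*n j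
    all-coprime-multiples : count (coprimeTo?∩p∣? n) (p * n) ≡ φ n
    all-coprime-multiples = begin
      count (coprimeTo?∩p∣? n) (p * n)          ≡⟨ count-coprime-multiples n ⟩
      count (coprimeTo?∩p∣? n ∘ (p *_)) n       ≡⟨ count-cong _ _ coprime[p*j,n]⇔coprime[j,n] n ⟩
      count (coprimeTo? n) n                    ≡⟨ φ≡count n ⟨
      φ n                                       ∎

  [p∸1]∣φ[p*n] : ∀ n → (p ∸ 1) ∣ φ (p * n)
  [p∸1]∣φ[p*n] = <-rec (λ n → (p ∸ 1) ∣ φ (p * n)) step
    where
    step : ∀ n → (∀ {m} → m < n → (p ∸ 1) ∣ φ (p * m)) → (p ∸ 1) ∣ φ (p * n)
    step zero _ rewrite *-zeroʳ p = (p ∸ 1) ∣0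
    step n@(suc _) ih with p ∣? n
    ... | no  p∤n = subst ((p ∸ 1) ∣_) (sym (p∤n⇒φ[p*n]≡[p∸1]*φ[n] p∤n)) (m∣m*n (φ n))
    ... | yes p∣n = subst ((p ∸ 1) ∣_) (sym (p∣n⇒φ[p*n]≡p*φ[n] p∣n)) (∣n⇒∣m*n p [p∸1]∣φ[n])
      where
      [p∸1]∣φ[n] : (p ∸ 1) ∣ φ n
      [p∸1]∣φ[n] = subst (λ m → (p ∸ 1) ∣ φ m) (sym (m∣n⇒n≡m*quotient p∣n))
                         (ih (quotient-< p∣n {{prime⇒nonTrivial pp}}))

  p∣n⇒[p∸1]∣φ[n] : ∀ {n} → p ∣ n → (p ∸ 1) ∣ φ n
  p∣n⇒[p∸1]∣φ[n] p∣n = subst (λ m → (p ∸ 1) ∣ φ m) (sym (m∣n⇒n≡m*quotient p∣n)) ([p∸1]∣φ[p*n] _)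

φ[n*2]≤n : ∀ n → φ (n * 2) ≤ n
φ[n*2]≤n n = begin
  φ (n * 2)                             ≡⟨ φ≡count (n * 2) ⟩
  count (coprimeTo? (n * 2)) (n * 2)    ≤⟨ count-mono-≤ _ _ coprime⇒odd (n * 2) ⟩
  count odd? (n * 2)                    ≡⟨ count-periodic odd? odd-shift n ⟩
  n * count odd? 2                      ≡⟨ *-identityʳ n ⟩
  n                                     ∎
  where
  open ≤-Reasoning
  odd? : Decidable (λ k → 2 ∤ k)
  odd? = ∁? (2 ∣?_)
  coprime⇒odd : (λ k → Coprime k (n * 2)) ⊆ (λ k → 2 ∤ k)
  coprime⇒odd c 2∣k = contradiction (c (2∣k , n∣m*n n)) λ ()
  odd-shift : ∀ k → 2 ∤ 2 + k ⇔ 2 ∤ k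
  odd-shift k = mk⇔ (λ 2∤2+k 2∣k → 2∤2+k (∣m∣n⇒∣m+n ∣-refl 2∣k))
                    (λ 2∤k 2∣2+k → 2∤k (∣m+n∣m⇒∣n 2∣2+k ∣-refl))

module _ {n} (3φ[n]≡2[n+1] : 3 * φ n ≡ 2 * (n + 1)) where

  2∤n : 2 ∤ n
  2∤n (divides m refl) = <⇒≱ 3m<4m+2 (begin
    2 * (m * 2 + 1)  ≡⟨ 3φ[n]≡2[n+1] ⟨
    3 * φ (m * 2)    ≤⟨ *-monoʳ-≤ 3 (φ[n*2]≤n m) ⟩
    3 * m            ∎)
    where
    open ≤-Reasoning
    3m+[m+2]≡2[2m+1] : ∀ m → 3 * m + suc (m + 1) ≡ 2 * (m * 2 + 1)
    3m+[m+2]≡2[2m+1] = solve-∀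
    3m<4m+2 : 3 * m < 2 * (m * 2 + 1)
    3m<4m+2 = subst (3 * m <_) (3m+[m+2]≡2[2m+1] m) (m<m+n (3 * m) z<s)

  ∣φ[n]∧∣n⇒∣2 : ∀ {d} → d ∣ φ n → d ∣ n → d ∣ 2
  ∣φ[n]∧∣n⇒∣2 {d} d∣φ[n] d∣n = ∣m+n∣m⇒∣n d∣2n+2 (∣n⇒∣m*n 2 d∣n)
    where
    d∣2n+2 : d ∣ 2 * n + 2
    d∣2n+2 = subst (d ∣_) (trans 3φ[n]≡2[n+1] (*-distribˡ-+ 2 n 1)) (∣n⇒∣m*n 3 d∣φ[n])

corollary2 : (n p r : ℕ) → 0 < n → 3 * φ n ≡ 2 * (n + 1) →
             Prime p → Prime r → p * r ∣ n → p ∤ (r ∸ 1)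
corollary2 n p r _ eq pp pr pr∣n p∣r∸1 = 2∤n eq (subst (_∣ n) p≡2 p∣n)
  where
  p∣n : p ∣ n
  p∣n = m*n∣⇒m∣ p r pr∣n
  p∣φ[n] : p ∣ φ n
  p∣φ[n] = ∣-trans p∣r∸1 (p∣n⇒[p∸1]∣φ[n] pr (m*n∣⇒n∣ p r pr∣n))
  p≡2 : p ≡ 2
  p≡2 = fromInj₂ (λ p≡1 → contradiction p≡1 (prime⇒≢1 pp))
                 (prime⇒irreducible prime[2] (∣φ[n]∧∣n⇒∣2 eq p∣φ[n] p∣n))
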